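{- Let $G=(V,E)$ be a directed acyclic graph with no active cycle, and let $T: x_0\sim x_1\sim\cdots\sim x_n\sim x_{n+1}$ ($n\ge0$) be a trail in $G$. If $T$ has the minimum number of nodes among all trails between $x_0$ and $x_{n+1}$ activated by the empty set (i.e. with no converging connection), then $T$ has no chords.
   Context: Graphs are finite, simple, without loops. A trail is a sequence of pairwise distinct nodes with consecutive nodes adjacent (arc in either direction). An interior node $v_j$ is a converging connection if $v_{j-1}\to v_j\leftarrow v_{j+1}$, otherwise serial or diverging. A chord of a trail is an arc of $G$ between two nodes of the trail that are not consecutive on it. $G$ contains an active cycle if there exist a node $v$, distinct parents $w,z$ of $v$, and a trail $w\sim y_1\sim\cdots\sim y_m\sim z$ with $m\ge1$ all of whose interior nodes are serial or diverging connections, such that the cycle $v,w,y_1,\dots,y_m,z$ has no arc of $G$ between two of its nodes that are not consecutive in this cyclic order. -}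

module Defs where

open import Data.Nat using (ℕ; _≤_)
open import Data.Fin using (Fin)
open import Data.Bool using (Bool; T)
open import Data.List using (List; []; _∷_; _++_; [_]; length)
open import Data.List.Membership.Propositional using (_∈_)
open import Data.List.Relation.Unary.Unique.Propositional using (Unique)
open import Data.List.Relation.Unary.Linked using (Linked)
open import Data.Product using (Σ; ∃; _×_; _,_)
open import Data.Sum using (_⊎_)
open import Data.Empty using (⊥)
open import Relation.Nullary using (¬_)
open import Relation.Binary.PropositionalEquality using (_≡_; _≢_)
open import Relation.Binary.Construct.Closure.Transitive using (TransClosure)

Graph : ℕ → Set
Graph N = Fin N → Fin N → Bool

module _ {N : ℕ} (G : Graph N) where

  Arc : Fin N → Fin N → Set
  Arc a b = T (G a b)

  IsDAG : Set
  IsDAG = ∀ v → ¬ TransClosure Arc v v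

  Adj : Fin N → Fin N → Set
  Adj a b = Arc a b ⊎ Arc b a

  IsTrail : List (Fin N) → Set
  IsTrail xs = Unique xs × Linked Adj xs

  HasConverging : List (Fin N) → Set
  HasConverging xs =
    Σ (List (Fin N)) λ pre → Σ (List (Fin N)) λ post →
    Σ (Fin N) λ a → Σ (Fin N) λ b → Σ (Fin N) λ c →
      (xs ≡ pre ++ (a ∷ b ∷ c ∷ post)) × Arc a b × Arc c b

  ActiveByEmpty : List (Fin N) → Set
  ActiveByEmpty xs = ¬ HasConverging xs

  Consecutive : List (Fin N) → Fin N → Fin N → Set
  Consecutive xs u v =
    Σ (List (Fin N)) λ pre → Σ (List (Fin N)) λ post →
      xs ≡ pre ++ (u ∷ v ∷ post)

  Chord : List (Fin N) → Fin N → Fin N → Set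
  Chord xs u v = u ∈ xs × v ∈ xs × Arc u v
               × ¬ Consecutive xs u v × ¬ Consecutive xs v u

  HasChord : List (Fin N) → Set
  HasChord xs = Σ (Fin N) λ u → Σ (Fin N) λ v → Chord xs u v

  TrailBetween : Fin N → Fin N → List (Fin N) → Set
  TrailBetween x y xs =
    Σ (List (Fin N)) λ mid → (xs ≡ x ∷ (mid ++ [ y ])) × IsTrail xs

  -- consecutive in the cyclic order of the cycle h, c₁, …, c_k
  -- (the last node c_k is followed by h): appending h closes the cycle
  CyclicConsecutive : Fin N → List (Fin N) → Fin N → Fin N → Set
  CyclicConsecutive h cs u v =
    Consecutive (h ∷ cs ++ [ h ]) u v ⊎ Consecutive (h ∷ cs ++ [ h ]) v u

  HasActiveCycle : Set
  HasActiveCycle =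
    Σ (Fin N) λ v → Σ (Fin N) λ w → Σ (Fin N) λ z →
    Σ (Fin N) λ y₁ → Σ (List (Fin N)) λ ys →
      Arc w v × Arc z v × w ≢ z
      × IsTrail (w ∷ y₁ ∷ ys ++ [ z ])
      × ActiveByEmpty (w ∷ y₁ ∷ ys ++ [ z ])
      × Unique (v ∷ w ∷ y₁ ∷ ys ++ [ z ])
      × (∀ a b → a ∈ (v ∷ w ∷ y₁ ∷ ys ++ [ z ]) → b ∈ (v ∷ w ∷ y₁ ∷ ys ++ [ z ])
           → Arc a b → CyclicConsecutive v (w ∷ y₁ ∷ ys ++ [ z ]) a b)

{-# OPTIONS --safe #-}
-- Cutting out the part of T strictly between the ends u, v of a chord leaves a
-- shorter trail with the same endpoints, so it suffices that the cut trail is still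
-- active. Only the two triples at the junction are new. If u → v ← s with s the
-- successor of v, then, as T has no converging connection, every arc of T between u
-- and v points back towards u, giving a directed path v ⇝ u closed into a cycle by
-- u → v; the junction at u is the mirror image, handled by reversing the trail.
module Submission where

open import Defs
open import Data.Nat using (ℕ; _≤_; _<_; s≤s)
open import Data.Nat.Properties using (<⇒≱)
open import Data.Fin using (Fin)
open import Data.List using (List; []; _∷_; _++_; [_]; _∷ʳ_; length; reverse; _ʳ++_)
open import Data.List.Properties
  using (∷-injectiveˡ; ∷-injectiveʳ; ++-assoc; length-++-≤ʳ; reverse-++; unfold-reverse; reverse-involutive)
open import Data.List.Membership.Propositional using (_∈_)
open import Data.List.Membership.Propositional.Properties using (∈-∃++)
open import Data.List.Relation.Unary.Any using (here; there)
open import Data.List.Relation.Unary.AllPairs using (AllPairs; []; _∷_)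
open import Data.List.Relation.Unary.Unique.Propositional using (Unique)
open import Data.List.Relation.Unary.Linked as Linked using (Linked; []; [-]; _∷_)
open import Data.List.Relation.Binary.Sublist.Propositional as Sublist using (_⊆_; _⊇_; []; _∷_; ⊆-refl)
open import Data.List.Relation.Binary.Sublist.Propositional.Properties using (All-resp-⊆; ++⁺; ++⁺ˡ)
open import Data.Product using (∃; _×_; _,_; proj₂)
open import Data.Sum using (_⊎_; inj₁; inj₂; map₁; swap)
open import Data.Empty using (⊥-elim)
open import Function using (_∘_)
open import Relation.Nullary using (¬_)
open import Level using (0ℓ)
open import Relation.Binary using (Rel; Symmetric; _Respects_)
open import Relation.Binary.PropositionalEquality
  using (_≡_; _≢_; refl; sym; trans; cong; cong₂; subst; module ≡-Reasoning)
open import Relation.Binary.Construct.Closure.Transitive as Plus using (TransClosure; _∷_)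

module _ {A : Set} where

  reverse-++-∷ : ∀ (xs : List A) y ys → reverse (xs ++ y ∷ ys) ≡ reverse ys ++ y ∷ reverse xs
  reverse-++-∷ xs y ys = begin
    reverse (xs ++ y ∷ ys)          ≡⟨ reverse-++ xs (y ∷ ys) ⟩
    reverse (y ∷ ys) ++ reverse xs  ≡⟨ cong (_++ reverse xs) (unfold-reverse y ys) ⟩
    (reverse ys ∷ʳ y) ++ reverse xs ≡⟨ ++-assoc (reverse ys) [ y ] (reverse xs) ⟩
    reverse ys ++ y ∷ reverse xs    ∎
    where open ≡-Reasoning

  reverse-++-∷-++-∷ : ∀ (P : List A) u M v S →
    reverse (P ++ u ∷ M ++ v ∷ S) ≡ reverse S ++ v ∷ reverse M ++ u ∷ reverse P
  reverse-++-∷-++-∷ P u M v S = begin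
    reverse (P ++ u ∷ M ++ v ∷ S)                 ≡⟨ reverse-++-∷ P u (M ++ v ∷ S) ⟩
    reverse (M ++ v ∷ S) ++ u ∷ reverse P          ≡⟨ cong (_++ u ∷ reverse P) (reverse-++-∷ M v S) ⟩
    (reverse S ++ v ∷ reverse M) ++ u ∷ reverse P ≡⟨ ++-assoc (reverse S) (v ∷ reverse M) (u ∷ reverse P) ⟩
    reverse S ++ v ∷ reverse M ++ u ∷ reverse P   ∎
    where open ≡-Reasoning

  ∷ʳ-suffix : ∀ (Q : List A) {z R m y} → Q ++ z ∷ R ≡ m ∷ʳ y → ∃ λ m′ → z ∷ R ≡ m′ ∷ʳ y
  ∷ʳ-suffix []          eq = _ , eq
  ∷ʳ-suffix (_ ∷ [])    {m = []}    ()
  ∷ʳ-suffix (_ ∷ _ ∷ _) {m = []}    ()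
  ∷ʳ-suffix (_ ∷ Q)     {m = _ ∷ _} eq = ∷ʳ-suffix Q (∷-injectiveʳ eq)

  shortcut-endpoints : ∀ (P : List A) {u M v S x mid y} →
    P ++ u ∷ M ++ v ∷ S ≡ x ∷ mid ∷ʳ y → ∃ λ mid′ → P ++ u ∷ v ∷ S ≡ x ∷ mid′ ∷ʳ y
  shortcut-endpoints [] {M = M} eq with ∷ʳ-suffix M (∷-injectiveʳ eq)
  ... | m′ , v∷S≡ = m′ , cong₂ _∷_ (∷-injectiveˡ eq) v∷S≡
  shortcut-endpoints (_ ∷ P) {u} {M} {v} {S} {y = y} eq
    with ∷ʳ-suffix (P ++ u ∷ M) (trans (++-assoc P (u ∷ M) (v ∷ S)) (∷-injectiveʳ eq))
  ... | m′ , v∷S≡ = P ++ u ∷ m′ , cong₂ _∷_ (∷-injectiveˡ eq)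
                      (trans (cong (λ zs → P ++ u ∷ zs) v∷S≡) (sym (++-assoc P (u ∷ m′) [ y ])))

  shortcut-shorter : ∀ (P : List A) {u m M v S} →
    length (P ++ u ∷ v ∷ S) < length (P ++ u ∷ m ∷ M ++ v ∷ S)
  shortcut-shorter []      {M = M} {v} {S} = s≤s (s≤s (length-++-≤ʳ (v ∷ S) {M}))
  shortcut-shorter (_ ∷ P)                 = s≤s (shortcut-shorter P)

  shortcut-⊆ : ∀ (P : List A) {u M v S} → P ++ u ∷ v ∷ S ⊆ P ++ u ∷ M ++ v ∷ S
  shortcut-⊆ P {M = M} = ++⁺ ⊆-refl (refl ∷ ++⁺ˡ M ⊆-refl)

  AllPairs-resp-⊇ : ∀ {R : Rel A 0ℓ} → AllPairs R Respects _⊇_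
  AllPairs-resp-⊇ []               []         = []
  AllPairs-resp-⊇ (_ Sublist.∷ʳ τ) (_ ∷ pxs)  = AllPairs-resp-⊇ τ pxs
  AllPairs-resp-⊇ (refl ∷ τ)       (px ∷ pxs) = All-resp-⊆ τ px ∷ AllPairs-resp-⊇ τ pxs

module _ {A : Set} {R : Rel A 0ℓ} where

  Linked-++⁻ʳ : ∀ xs {ys} → Linked R (xs ++ ys) → Linked R ys
  Linked-++⁻ʳ []       rs = rs
  Linked-++⁻ʳ (_ ∷ xs) rs = Linked-++⁻ʳ xs (Linked.tail rs)

  Linked-splice : ∀ P {x xs ys} → Linked R (P ++ x ∷ xs) → Linked R (x ∷ ys) → Linked R (P ++ x ∷ ys)
  Linked-splice []          _        rys = rys
  Linked-splice (_ ∷ [])    (r ∷ _)  rys = r ∷ rys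
  Linked-splice (_ ∷ _ ∷ P) (r ∷ rs) rys = r ∷ Linked-splice (_ ∷ P) rs rys

  Linked-ʳ++ : Symmetric R → ∀ {x xs ys} → Linked R (x ∷ xs) → Linked R (x ∷ ys) → Linked R (xs ʳ++ x ∷ ys)
  Linked-ʳ++ sym [-]      rys = rys
  Linked-ʳ++ sym (r ∷ rs) rys = Linked-ʳ++ sym rs (sym r ∷ rys)

  Linked-reverse : Symmetric R → ∀ {xs} → Linked R xs → Linked R (reverse xs)
  Linked-reverse sym []              = []
  Linked-reverse sym {_ ∷ _} rs = Linked-ʳ++ sym rs [-]

  Linked⇒TransClosure : ∀ {x} xs {y ys} → Linked R (x ∷ xs ++ y ∷ ys) → TransClosure R x y
  Linked⇒TransClosure []       (r ∷ _)  = Plus.[ r ]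
  Linked⇒TransClosure (_ ∷ xs) (r ∷ rs) = r ∷ Linked⇒TransClosure xs rs

data Converging {A : Set} (R : Rel A 0ℓ) : List A → Set where
  here  : ∀ {a b c xs} → R a b → R c b → Converging R (a ∷ b ∷ c ∷ xs)
  there : ∀ {x xs} → Converging R xs → Converging R (x ∷ xs)

module _ {A : Set} {R : Rel A 0ℓ} where

  Converging-++⁺ˡ : ∀ {xs ys} → Converging R xs → Converging R (xs ++ ys)
  Converging-++⁺ˡ (here ab cb) = here ab cb
  Converging-++⁺ˡ (there c)    = there (Converging-++⁺ˡ c)

  Converging-++⁺ʳ : ∀ xs {ys} → Converging R ys → Converging R (xs ++ ys)
  Converging-++⁺ʳ []       c = c
  Converging-++⁺ʳ (_ ∷ xs) c = there (Converging-++⁺ʳ xs c)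

  Converging-++-∷-∷⁻ : ∀ xs {a b ys} → Converging R (xs ++ a ∷ b ∷ ys) →
    Converging R (xs ++ a ∷ b ∷ []) ⊎ Converging R (a ∷ b ∷ ys)
  Converging-++-∷-∷⁻ []              c            = inj₂ c
  Converging-++-∷-∷⁻ (_ ∷ [])        (here ab cb) = inj₁ (here ab cb)
  Converging-++-∷-∷⁻ (_ ∷ _ ∷ [])    (here ab cb) = inj₁ (here ab cb)
  Converging-++-∷-∷⁻ (_ ∷ _ ∷ _ ∷ _) (here ab cb) = inj₁ (here ab cb)
  Converging-++-∷-∷⁻ (_ ∷ xs)        (there c)    = map₁ there (Converging-++-∷-∷⁻ xs c)

  Converging-reverse : ∀ {xs} → Converging R xs → Converging R (reverse xs)
  Converging-reverse (here {a} {b} {c} {xs} ab cb) =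
    subst (Converging R) (sym (reverse-++ (a ∷ b ∷ c ∷ []) xs)) (Converging-++⁺ʳ (reverse xs) (here cb ab))
  Converging-reverse (there {x} {xs} c) =
    subst (Converging R) (sym (unfold-reverse x xs)) (Converging-++⁺ˡ (Converging-reverse c))

data Splitting {A : Set} (u v : A) (xs : List A) : Set where
  u-first : ∀ P M S → xs ≡ P ++ u ∷ M ++ v ∷ S → Splitting u v xs
  v-first : ∀ P M S → xs ≡ P ++ v ∷ M ++ u ∷ S → Splitting u v xs

splitting : ∀ {A : Set} {u v : A} {xs} → u ≢ v → u ∈ xs → v ∈ xs → Splitting u v xs
splitting u≢v (here refl) (here refl) = ⊥-elim (u≢v refl)
splitting _ (here refl) (there v∈xs) with ∈-∃++ v∈xs
... | M , S , refl = u-first [] M S refl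
splitting _ (there u∈xs) (here refl) with ∈-∃++ u∈xs
... | M , S , refl = v-first [] M S refl
splitting {xs = x ∷ _} u≢v (there u∈xs) (there v∈xs) with splitting u≢v u∈xs v∈xs
... | u-first P M S refl = u-first (x ∷ P) M S refl
... | v-first P M S refl = v-first (x ∷ P) M S refl

module _ {N : ℕ} (G : Graph N) where

  private
    V = Fin N

  HasConverging⇒Converging : ∀ {xs} → HasConverging G xs → Converging (Arc G) xs
  HasConverging⇒Converging ([] , _ , _ , _ , _ , refl , ab , cb) = here ab cb
  HasConverging⇒Converging (_ ∷ pre , post , a , b , c , refl , ab , cb) =
    there (HasConverging⇒Converging (pre , post , a , b , c , refl , ab , cb))

  Converging⇒HasConverging : ∀ {xs} → Converging (Arc G) xs → HasConverging G xs
  Converging⇒HasConverging (here ab cb) = [] , _ , _ , _ , _ , refl , ab , cb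
  Converging⇒HasConverging (there {x} conv) with Converging⇒HasConverging conv
  ... | pre , post , a , b , c , eq , ab , cb = x ∷ pre , post , a , b , c , cong (x ∷_) eq , ab , cb

  ActiveWalk : List V → Set
  ActiveWalk xs = Linked (Adj G) xs × ¬ Converging (Arc G) xs

  ActiveWalk-++⁻ʳ : ∀ xs {ys} → ActiveWalk (xs ++ ys) → ActiveWalk ys
  ActiveWalk-++⁻ʳ xs (adj , ¬conv) = Linked-++⁻ʳ xs adj , ¬conv ∘ Converging-++⁺ʳ xs

  ActiveWalk-reverse : ∀ {xs} → ActiveWalk xs → ActiveWalk (reverse xs)
  ActiveWalk-reverse {xs} (adj , ¬conv) =
    Linked-reverse swap adj ,
    ¬conv ∘ subst (Converging (Arc G)) (reverse-involutive xs) ∘ Converging-reverse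

  ActiveWalk-directed : ∀ {x y zs} → Arc G x y → ActiveWalk (x ∷ y ∷ zs) → Linked (Arc G) (x ∷ y ∷ zs)
  ActiveWalk-directed {zs = []}    xy _                         = xy ∷ [-]
  ActiveWalk-directed {zs = _ ∷ _} xy (_ ∷ inj₁ yz ∷ adj , ¬conv) =
    xy ∷ ActiveWalk-directed yz (inj₁ yz ∷ adj , ¬conv ∘ there)
  ActiveWalk-directed {zs = _ ∷ _} xy (_ ∷ inj₂ zy ∷ _ , ¬conv)  = ⊥-elim (¬conv (here xy zy))

  -- After p → u the walk is a directed path u ⇝ v, which v → u would close into a cycle.
  ActiveWalk-no-return : IsDAG G → ∀ Q {p u M v S} → ActiveWalk (Q ++ p ∷ u ∷ M ++ v ∷ S) →
    Arc G p u → ¬ Arc G v u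
  ActiveWalk-no-return dag Q {M = M} walk pu vu =
    dag _ (Linked⇒TransClosure M (Linked.tail (ActiveWalk-directed pu (ActiveWalk-++⁻ʳ Q walk))) Plus.∷ʳ vu)

  shortcut-right-not-converging : IsDAG G → ∀ P {u M v S} → ActiveWalk (P ++ u ∷ M ++ v ∷ S) →
    ¬ Converging (Arc G) (u ∷ v ∷ S)
  shortcut-right-not-converging dag P {u} {M} {v} {s ∷ S} walk (here uv sv) =
    ActiveWalk-no-return dag (reverse S) (subst ActiveWalk reversed (ActiveWalk-reverse walk)) sv uv
    where
    open ≡-Reasoning
    reversed : reverse (P ++ u ∷ M ++ v ∷ s ∷ S) ≡ reverse S ++ s ∷ v ∷ reverse M ++ u ∷ reverse P
    reversed = begin
      reverse (P ++ u ∷ M ++ v ∷ s ∷ S)                       ≡⟨ reverse-++-∷-++-∷ P u M v (s ∷ S) ⟩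
      reverse (s ∷ S) ++ v ∷ reverse M ++ u ∷ reverse P      ≡⟨ cong (_++ _) (unfold-reverse s S) ⟩
      (reverse S ∷ʳ s) ++ v ∷ reverse M ++ u ∷ reverse P     ≡⟨ ++-assoc (reverse S) [ s ] _ ⟩
      reverse S ++ s ∷ v ∷ reverse M ++ u ∷ reverse P        ∎
  shortcut-right-not-converging dag P {M = M} walk (there conv) =
    proj₂ walk (Converging-++⁺ʳ P (there (Converging-++⁺ʳ M conv)))

  shortcut-not-converging : IsDAG G → ∀ P {u M v S} → ActiveWalk (P ++ u ∷ M ++ v ∷ S) →
    ¬ Converging (Arc G) (P ++ u ∷ v ∷ S)
  shortcut-not-converging dag P {u} {M} {v} {S} walk conv with Converging-++-∷-∷⁻ P conv
  ... | inj₂ right = shortcut-right-not-converging dag P walk right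
  ... | inj₁ left  =
    shortcut-right-not-converging dag (reverse S)
      (subst ActiveWalk (reverse-++-∷-++-∷ P u M v S) (ActiveWalk-reverse walk))
      (subst (Converging (Arc G)) (reverse-++ P (u ∷ v ∷ [])) (Converging-reverse left))

  shortcut-trail : IsDAG G → ∀ {x y} P {u m M v S} → Adj G u v →
    TrailBetween G x y (P ++ u ∷ m ∷ M ++ v ∷ S) → ActiveByEmpty G (P ++ u ∷ m ∷ M ++ v ∷ S) →
    TrailBetween G x y (P ++ u ∷ v ∷ S) × ActiveByEmpty G (P ++ u ∷ v ∷ S)
  shortcut-trail dag P {u} {m} {M} {v} {S} adj (mid , ends , unique , linked) active
    with shortcut-endpoints P {M = m ∷ M} ends
  ... | mid′ , ends′ = (mid′ , ends′ , unique′ , linked′) , active′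
    where
    unique′ : Unique (P ++ u ∷ v ∷ S)
    unique′ = AllPairs-resp-⊇ (shortcut-⊆ P {M = m ∷ M}) unique

    linked′ : Linked (Adj G) (P ++ u ∷ v ∷ S)
    linked′ = Linked-splice P linked (adj ∷ Linked-++⁻ʳ (u ∷ m ∷ M) (Linked-++⁻ʳ P linked))

    active′ : ActiveByEmpty G (P ++ u ∷ v ∷ S)
    active′ = shortcut-not-converging dag P {M = m ∷ M} (linked , active ∘ Converging⇒HasConverging)
            ∘ HasConverging⇒Converging

  shortcut-not-shortest : IsDAG G → ∀ {x y} P {u m M v S} →
    TrailBetween G x y (P ++ u ∷ m ∷ M ++ v ∷ S) → ActiveByEmpty G (P ++ u ∷ m ∷ M ++ v ∷ S) →
    (∀ T′ → TrailBetween G x y T′ → ActiveByEmpty G T′ → length (P ++ u ∷ m ∷ M ++ v ∷ S) ≤ length T′) →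
    ¬ Adj G u v
  shortcut-not-shortest dag P trail active shortest adj with shortcut-trail dag P adj trail active
  ... | trail′ , active′ = <⇒≱ (shortcut-shorter P) (shortest _ trail′ active′)

lemma4p7 : (N : ℕ) (G : Graph N) → IsDAG G → ¬ HasActiveCycle G →
    (x₀ y : Fin N) (T : List (Fin N)) →
    TrailBetween G x₀ y T → ActiveByEmpty G T →
    (∀ (T′ : List (Fin N)) → TrailBetween G x₀ y T′ → ActiveByEmpty G T′ →
      length T ≤ length T′) →
    ¬ HasChord G T
lemma4p7 N G dag _ x₀ y T trail active shortest (u , v , u∈T , v∈T , uv , ¬uv-consecutive , ¬vu-consecutive)
  with splitting (λ { refl → dag u Plus.[ uv ] }) u∈T v∈T
... | u-first P []      S refl = ¬uv-consecutive (P , S , refl)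
... | v-first P []      S refl = ¬vu-consecutive (P , S , refl)
... | u-first P (_ ∷ M) S refl = shortcut-not-shortest G dag P trail active shortest (inj₁ uv)
... | v-first P (_ ∷ M) S refl = shortcut-not-shortest G dag P trail active shortest (inj₂ uv)
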